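{- Let $h\ge 1$, and let $S_0$ be an instance consisting of $n$ full bins and $k$ empty bins of capacity $h$ over a finite color set $C$ (each color occurring a positive multiple of $h$ times). Then $S_0$ can be transformed into a sorted configuration by a finite sequence of ball-moves if and only if it can be transformed into a sorted configuration by a finite sequence of water-moves. That is, $S_0$ is a yes-instance of $\mathrm{BSP}$ if and only if it is a yes-instance of $\mathrm{WSP}$.
   Context: Setting: $B$ is a finite set of bins, each of capacity $h$, and $C$ a finite set of colors. A configuration is a map $S$ assigning to each bin $b$ a sequence $S(b)$ of colors of length at most $h$, listed from bottom to top; the last element is the top unit. A bin is full if $|S(b)|=h$, empty if $|S(b)|=0$. An instance is a configuration in which $n$ bins are full and $k$ bins are empty, and each color occurs exactly $hj$ times for some positive integer $j$. A configuration is sorted if every bin is either empty or contains $h$ units all of the same color. Ball-move: choose distinct bins $b_1,b_2$ with $S(b_1)$ nonempty with top color $c$, such that $S(b_2)$ is empty or has top color $c$ and $|S(b_2)|<h$; remove the top unit of $b_1$ and append $c$ on top of $b_2$; other bins unchanged. Water-move: choose distinct bins $b_1,b_2$, a color $c$ and $m\ge1$ such that $S(b_1)$ ends with $c^m$ (m copies of $c$), $S(b_2)$ is empty or has top color $c$, and $|S(b_2)|+m\le h$; remove those $m$ units from the top of $b_1$ and append $c^m$ on top of $b_2$, where $m$ must be maximal in the sense that after the move either the new top of $b_1$ is not $c$ (or $b_1$ is empty) or $b_2$ is full; other bins unchanged. $\mathrm{BSP}$ (resp. $\mathrm{WSP}$) is the problem of deciding whether a given instance can be transformed into a sorted configuration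 by a finite sequence of ball-moves (resp. water-moves). -}

module Defs where

open import Data.Nat using (ℕ; _+_; _*_; _≤_; _<_; _≥_)
open import Data.Fin using (Fin)
open import Data.Fin.Properties using () renaming (_≟_ to _≟ᶠ_)
open import Data.List using (List; []; _∷ʳ_; _++_; replicate; length; filter; map; allFin)
open import Data.Nat.ListAction using (sum)
open import Data.Product using (Σ; ∃; ∃-syntax; _×_; _,_)
open import Data.Sum using (_⊎_)
open import Relation.Nullary using (¬_)
open import Relation.Binary.PropositionalEquality using (_≡_; _≢_)
open import Relation.Binary.Construct.Closure.ReflexiveTransitive using (Star)

-- Bins are Fin nb (the finite set B), colours are Fin nc (the finite set C).
-- A configuration assigns to each bin a list of colours, bottom to top;
-- the LAST element of the list is the top unit.
Config : ℕ → ℕ → Set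
Config nb nc = Fin nb → List (Fin nc)

module _ {nb nc : ℕ} where

  EmptyOrTop : List (Fin nc) → Fin nc → Set
  EmptyOrTop xs c = xs ≡ [] ⊎ ∃[ ys ] xs ≡ ys ∷ʳ c

  TopNot : List (Fin nc) → Fin nc → Set
  TopNot xs c = ¬ (∃[ ys ] xs ≡ ys ∷ʳ c)

  BallMove : ℕ → Config nb nc → Config nb nc → Set
  BallMove h S S' =
    Σ (Fin nb) λ b₁ → Σ (Fin nb) λ b₂ → b₁ ≢ b₂ ×
    Σ (List (Fin nc)) λ xs → Σ (Fin nc) λ c →
      S b₁ ≡ xs ∷ʳ c ×
      EmptyOrTop (S b₂) c ×
      length (S b₂) < h ×
      S' b₁ ≡ xs ×
      S' b₂ ≡ S b₂ ∷ʳ c ×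
      (∀ b → b ≢ b₁ → b ≢ b₂ → S' b ≡ S b)

  WaterMove : ℕ → Config nb nc → Config nb nc → Set
  WaterMove h S S' =
    Σ (Fin nb) λ b₁ → Σ (Fin nb) λ b₂ → b₁ ≢ b₂ ×
    Σ (Fin nc) λ c → Σ ℕ λ m → m ≥ 1 ×
    Σ (List (Fin nc)) λ xs →
      S b₁ ≡ xs ++ replicate m c ×
      EmptyOrTop (S b₂) c ×
      length (S b₂) + m ≤ h ×
      (TopNot xs c ⊎ length (S b₂) + m ≡ h) ×
      S' b₁ ≡ xs ×
      S' b₂ ≡ S b₂ ++ replicate m c ×
      (∀ b → b ≢ b₁ → b ≢ b₂ → S' b ≡ S b)

  Sorted : ℕ → Config nb nc → Set
  Sorted h S = ∀ b → S b ≡ [] ⊎ ∃[ c ] S b ≡ replicate h c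

  occurrences : Config nb nc → Fin nc → ℕ
  occurrences S c = sum (map (λ b → length (filter (_≟ᶠ c) (S b))) (allFin nb))

  IsInstance : ℕ → Config nb nc → Set
  IsInstance h S =
    (∀ b → length (S b) ≡ h ⊎ S b ≡ []) ×
    (∀ c → ∃[ j ] j ≥ 1 × occurrences S c ≡ h * j)

  BSP : ℕ → Config nb nc → Set
  BSP h S = ∃[ T ] Star (BallMove h) S T × Sorted h T

  WSP : ℕ → Config nb nc → Set
  WSP h S = ∃[ T ] Star (WaterMove h) S T × Sorted h T

-- A water move of m units is m successive ball moves, which gives one direction.
-- Conversely, a ball-move solution is replayed by water moves keeping the water
-- configuration a shadow of the ball configuration: each water bin agrees with its
-- ball bin except for the length of the maximal one-coloured top run, and for every
-- colour the top runs have the same total length on both sides. A ball move only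
-- changes ball runs; when it empties the run of its source bin, the surplus water
-- there is poured, by maximal water moves, onto bins of that colour whose water run
-- is shorter than their ball run. Such bins exist by the colour balance and have
-- room because their ball bins fit. Once the balls are sorted, no water run can
-- exceed its ball run, so the balance makes them equal and the water is sorted too.
module Submission where

open import Defs
open import Data.Nat using (ℕ; zero; suc; _+_; _∸_; _⊓_; _≤_; _<_; _≥_; z≤n; s≤s; _<?_)
open import Data.Nat.Properties
  using ( +-assoc; +-comm; +-mono-≤; +-mono-<-≤; +-mono-≤-<; +-monoʳ-≤; +-monoʳ-<; +-cancelˡ-≤
        ; ≤-reflexive; ≤-trans; ≤-<-trans; <-≤-trans; <⇒≤; <⇒≢; ≮⇒≥; ≤∧≮⇒≡; n≮0; n≢0⇒n>0
        ; m+n≡0⇒n≡0; m+1+n≢0; m<m+n; m∸n+n≡m; m+[n∸m]≡n; m∸n≤m; n∸n≡0; m<n⇒0<n∸m; ∸-monoʳ-<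
        ; ⊓-sel; ⊓-glb; m⊓n≤m; m⊓n≤n; +-0-monoid; +-commutativeSemigroup; module ≤-Reasoning )
  renaming (_≟_ to _≟ℕ_)
open import Algebra.Properties.CommutativeSemigroup +-commutativeSemigroup using (xy∙z≈xz∙y)
open import Data.Nat.Induction using (<-wellFounded)
open import Data.Fin using (Fin; zero; suc)
open import Data.Fin.Properties using (_≟_; any?; suc-injective)
open import Data.List using (List; []; _∷_; _∷ʳ_; _++_; replicate; length)
open import Data.List.Properties
  using ( ∷-injectiveʳ; ∷ʳ-++; ∷ʳ-injectiveˡ; ∷ʳ-injectiveʳ; ++-assoc; ++-identityʳ
        ; length-++; length-++-≤ˡ; length-replicate )
open import Data.Product using (Σ-syntax; ∃-syntax; _×_; _,_; proj₁; proj₂; map₂)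
open import Data.Sum using (_⊎_; inj₁; inj₂; [_,_]′)
open import Function using (_∘_; id)
open import Data.Vec.Functional using (updateAt)
open import Data.Vec.Functional.Properties using (updateAt-updates; updateAt-minimal)
open import Algebra.Properties.Monoid.Sum +-0-monoid using (sum; sum-cong-≗)
open import Induction.WellFounded using (Acc; acc)
open import Relation.Nullary using (¬_; yes; no; contradiction)
open import Relation.Binary.Definitions using (DecidableEquality)
open import Relation.Binary.PropositionalEquality
open import Relation.Binary.Construct.Closure.ReflexiveTransitive using (Star; ε; _◅_; _◅◅_; _⋆)

module _ {A : Set} where

  -- Defs.EmptyOrTop and Defs.TopNot without their uninferable implicit bin count.
  _EndsWith_ : List A → A → Set
  xs EndsWith c = ∃[ ys ] xs ≡ ys ∷ʳ c

  Accepts : List A → A → Set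
  Accepts xs c = xs ≡ [] ⊎ xs EndsWith c

  ¬[]EndsWith : ∀ {c} → ¬ [] EndsWith c
  ¬[]EndsWith ([] , ())
  ¬[]EndsWith (_ ∷ _ , ())

  ++-replicate-∷ʳ : ∀ (P : List A) n c → (P ++ replicate n c) ∷ʳ c ≡ P ++ replicate (suc n) c
  ++-replicate-∷ʳ P n c = begin
    (P ++ replicate n c) ∷ʳ c   ≡⟨ ++-assoc P (replicate n c) (c ∷ []) ⟩
    P ++ (replicate n c ∷ʳ c)   ≡⟨ cong (P ++_) (replicate-∷ʳ n) ⟩
    P ++ replicate (suc n) c    ∎
    where
    open ≡-Reasoning
    replicate-∷ʳ : ∀ n → replicate n c ∷ʳ c ≡ replicate (suc n) c
    replicate-∷ʳ zero = refl
    replicate-∷ʳ (suc n) = cong (c ∷_) (replicate-∷ʳ n)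

  ++-replicate-+ : ∀ (P : List A) m n c → P ++ replicate (m + n) c ≡ (P ++ replicate m c) ++ replicate n c
  ++-replicate-+ P m n c = trans (cong (P ++_) (replicate-+ m)) (sym (++-assoc P (replicate m c) (replicate n c)))
    where
    replicate-+ : ∀ m → replicate (m + n) c ≡ replicate m c ++ replicate n c
    replicate-+ zero = refl
    replicate-+ (suc m) = cong (c ∷_) (replicate-+ m)

  length-++-replicate : ∀ (P : List A) n c → length (P ++ replicate n c) ≡ length P + n
  length-++-replicate P n c = trans (length-++ P) (cong (length P +_) (length-replicate n))

  ++-replicate-EndsWith : ∀ (P : List A) n c → (P ++ replicate (suc n) c) EndsWith c
  ++-replicate-EndsWith P n c = P ++ replicate n c , sym (++-replicate-∷ʳ P n c)

  run-positive : ∀ (P : List A) k {c} → ¬ P EndsWith c → (P ++ replicate k c) EndsWith c → 0 < k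
  run-positive P zero ¬ends ends = contradiction (subst (_EndsWith _) (++-identityʳ P) ends) ¬ends
  run-positive P (suc k) _ _ = s≤s z≤n

  ++-replicate-last : ∀ (P : List A) n {x c} → (P ++ replicate (suc n) x) EndsWith c → x ≡ c
  ++-replicate-last P n {x} (ys , eq) =
    sym (∷ʳ-injectiveʳ ys (P ++ replicate n x) (trans (sym eq) (sym (++-replicate-∷ʳ P n x))))

  topRun : DecidableEquality A → ∀ xs c → ∃[ P ] ∃[ k ] xs ≡ P ++ replicate k c × ¬ P EndsWith c
  topRun _≟ᴬ_ [] c = [] , 0 , refl , ¬[]EndsWith
  topRun _≟ᴬ_ (a ∷ xs) c with topRun _≟ᴬ_ xs c
  ... | p ∷ ps , k , xs≡ , maximal = a ∷ p ∷ ps , k , cong (a ∷_) xs≡ , λ where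
          (_ ∷ ys , eq) → maximal (ys , ∷-injectiveʳ eq)
  ... | [] , k , xs≡ , _ with a ≟ᴬ c
  ...   | yes refl = [] , suc k , cong (a ∷_) xs≡ , ¬[]EndsWith
  ...   | no a≢c = a ∷ [] , k , cong (a ∷_) xs≡ , λ where
          ([] , refl) → a≢c refl
          (_ ∷ ys , eq) → ¬[]EndsWith (ys , ∷-injectiveʳ eq)


module _ {A : Set} {n : ℕ} where

  updateAt₂ : (Fin n → A) → Fin n → (A → A) → Fin n → (A → A) → Fin n → A
  updateAt₂ f b₁ g₁ b₂ g₂ = updateAt (updateAt f b₁ g₁) b₂ g₂

  updateAt-elim : ∀ (P : Fin n → A → Set) {f : Fin n → A} b {a} → P b a → (∀ x → x ≢ b → P x (f x)) →
                  ∀ x → P x (updateAt f b (λ _ → a) x)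
  updateAt-elim P b Pba rest x with x ≟ b
  ... | yes refl = subst (P x) (sym (updateAt-updates x _)) Pba
  ... | no x≢b = subst (P x) (sym (updateAt-minimal x b _ x≢b)) (rest x x≢b)

  module _ {f : Fin n → A} {b₁ b₂ : Fin n} {g₁ g₂ : A → A} where

    updateAt₂-first : b₁ ≢ b₂ → updateAt₂ f b₁ g₁ b₂ g₂ b₁ ≡ g₁ (f b₁)
    updateAt₂-first b₁≢b₂ = trans (updateAt-minimal b₁ b₂ _ b₁≢b₂) (updateAt-updates b₁ f)

    updateAt₂-second : b₁ ≢ b₂ → updateAt₂ f b₁ g₁ b₂ g₂ b₂ ≡ g₂ (f b₂)
    updateAt₂-second b₁≢b₂ = trans (updateAt-updates b₂ _) (cong g₂ (updateAt-minimal b₂ b₁ f (b₁≢b₂ ∘ sym)))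

    updateAt₂-minimal : ∀ x → x ≢ b₁ → x ≢ b₂ → updateAt₂ f b₁ g₁ b₂ g₂ x ≡ f x
    updateAt₂-minimal x x≢b₁ x≢b₂ = trans (updateAt-minimal x b₂ _ x≢b₂) (updateAt-minimal x b₁ f x≢b₁)

module _ {n : ℕ} where

  elim₂ : ∀ {P : Fin n → Set} b₁ b₂ → P b₁ → P b₂ → (∀ x → x ≢ b₁ → x ≢ b₂ → P x) → ∀ x → P x
  elim₂ b₁ b₂ P₁ P₂ rest x with x ≟ b₁ | x ≟ b₂
  ... | yes refl | _ = P₁
  ... | no _ | yes refl = P₂
  ... | no x≢b₁ | no x≢b₂ = rest x x≢b₁ x≢b₂

  transfer : ℕ → Fin n → Fin n → (Fin n → ℕ) → Fin n → ℕ
  transfer m b₁ b₂ r = updateAt₂ r b₁ (_∸ m) b₂ (_+ m)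

sum-raise : ∀ {n} {f g : Fin n → ℕ} b {k} → g b ≡ f b + k → (∀ x → x ≢ b → g x ≡ f x) →
            sum g ≡ sum f + k
sum-raise {f = f} {g} zero {k} gb≡ rest = begin
  g zero + sum (g ∘ suc)      ≡⟨ cong₂ _+_ gb≡ (sum-cong-≗ (λ x → rest (suc x) λ ())) ⟩
  f zero + k + sum (f ∘ suc)  ≡⟨ xy∙z≈xz∙y (f zero) k _ ⟩
  f zero + sum (f ∘ suc) + k  ∎
  where open ≡-Reasoning
sum-raise {f = f} {g} (suc b) {k} gb≡ rest = begin
  g zero + sum (g ∘ suc)        ≡⟨ cong₂ _+_ (rest zero λ ()) (sum-raise b gb≡ λ x x≢b → rest (suc x) (x≢b ∘ suc-injective))
                                 ⟩
  f zero + (sum (f ∘ suc) + k)  ≡⟨ sym (+-assoc (f zero) _ k) ⟩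
  f zero + sum (f ∘ suc) + k    ∎
  where open ≡-Reasoning

sum-mono-≤ : ∀ {n} {f g : Fin n → ℕ} → (∀ x → f x ≤ g x) → sum f ≤ sum g
sum-mono-≤ {zero} le = z≤n
sum-mono-≤ {suc n} le = +-mono-≤ (le zero) (sum-mono-≤ (le ∘ suc))

sum-mono-< : ∀ {n} {f g : Fin n → ℕ} {b} → (∀ x → f x ≤ g x) → f b < g b → sum f < sum g
sum-mono-< {b = zero} le lt = +-mono-<-≤ lt (sum-mono-≤ (le ∘ suc))
sum-mono-< {b = suc b} le lt = +-mono-≤-< (le zero) (sum-mono-< (le ∘ suc) lt)

sum-≤-≡ : ∀ {n} {f g : Fin n → ℕ} → (∀ x → f x ≤ g x) → sum f ≡ sum g → ∀ x → f x ≡ g x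
sum-≤-≡ le eq x = ≤∧≮⇒≡ (le x) (λ lt → <⇒≢ (sum-mono-< le lt) eq)

sum-deficit : ∀ {n} {f g : Fin n → ℕ} {b} → sum f ≡ sum g → g b < f b → ∃[ x ] f x < g x
sum-deficit {f = f} {g} eq gb<fb with any? (λ x → f x <? g x)
... | yes deficit = deficit
... | no none = contradiction (sym eq) (<⇒≢ (sum-mono-< (λ x → ≮⇒≥ λ lt → none (x , lt)) gb<fb))

module _ {n : ℕ} where

  units : Fin n → ℕ → Fin n → ℕ
  units c k d with c ≟ d
  ... | yes _ = k
  ... | no _ = 0

  units-self : ∀ c k → units c k c ≡ k
  units-self c k with c ≟ c
  ... | yes _ = refl
  ... | no c≢c = contradiction refl c≢c

  units-zero : ∀ c d → units c 0 d ≡ 0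
  units-zero c d with c ≟ d
  ... | yes _ = refl
  ... | no _ = refl

  units-+ : ∀ c j k d → units c (j + k) d ≡ units c j d + units c k d
  units-+ c j k d with c ≟ d
  ... | yes _ = refl
  ... | no _ = refl

  units-mono-≤ : ∀ c {j k} d → j ≤ k → units c j d ≤ units c k d
  units-mono-≤ c d j≤k with c ≟ d
  ... | yes _ = j≤k
  ... | no _ = z≤n

  units-<⁻¹ : ∀ c {j k} d → units c j d < units c k d → c ≡ d × j < k
  units-<⁻¹ c d lt with c ≟ d
  ... | yes c≡d = c≡d , lt
  ... | no _ = contradiction lt n≮0

module _ {nb nc : ℕ} where

  tally : (Fin nb → Fin nc) → (Fin nb → ℕ) → Fin nc → ℕ
  tally col r d = sum λ b → units (col b) (r b) d

  tally-transfer : ∀ col r {m b₁ b₂} → col b₁ ≡ col b₂ → m ≤ r b₁ → ∀ d →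
                   tally col (transfer m b₁ b₂ r) d ≡ tally col r d
  tally-transfer col r {m} {b₁} {b₂} same m≤r₁ d = begin
    tally col (transfer m b₁ b₂ r) d     ≡⟨ sum-raise b₂ into-b₂ (λ x x≢b₂ → cong (at x) (updateAt-minimal x b₂ r′ x≢b₂))
                                          ⟩
    tally col r′ d + units (col b₂) m d  ≡⟨ cong (λ c → tally col r′ d + units c m d) (sym same) ⟩
    tally col r′ d + units (col b₁) m d  ≡⟨ sym (sum-raise b₁ outOf-b₁ λ x x≢b₁ →
                                                   cong (at x) (sym (updateAt-minimal x b₁ r x≢b₁))) ⟩
    tally col r d                        ∎
    where
    open ≡-Reasoning
    r′ : Fin nb → ℕ
    r′ = updateAt r b₁ (_∸ m)
    at : Fin nb → ℕ → ℕ
    at x k = units (col x) k d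
    into-b₂ : at b₂ (transfer m b₁ b₂ r b₂) ≡ at b₂ (r′ b₂) + at b₂ m
    into-b₂ = trans (cong (at b₂) (updateAt-updates b₂ r′)) (units-+ (col b₂) (r′ b₂) m d)
    outOf-b₁ : at b₁ (r b₁) ≡ at b₁ (r′ b₁) + at b₁ m
    outOf-b₁ = begin
      at b₁ (r b₁)              ≡⟨ cong (at b₁) (sym (m∸n+n≡m m≤r₁)) ⟩
      at b₁ (r b₁ ∸ m + m)      ≡⟨ units-+ (col b₁) (r b₁ ∸ m) m d ⟩
      at b₁ (r b₁ ∸ m) + at b₁ m ≡⟨ cong (λ k → at b₁ k + at b₁ m) (sym (updateAt-updates b₁ r)) ⟩
      at b₁ (r′ b₁) + at b₁ m   ∎

module BallToWater (h : ℕ) {nb nc : ℕ} where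

  record Layer : Set where
    field
      base     : List (Fin nc)
      colour   : Fin nc
      ballRun  : ℕ
      waterRun : ℕ
  open Layer

  record Shadows (Tb Wb : List (Fin nc)) (ℓ : Layer) : Set where
    field
      ball-split  : Tb ≡ base ℓ ++ replicate (ballRun ℓ) (colour ℓ)
      water-split : Wb ≡ base ℓ ++ replicate (waterRun ℓ) (colour ℓ)
      receptive   : 0 < ballRun ℓ → Accepts Wb (colour ℓ)
      maximal     : 0 < ballRun ℓ ⊎ 0 < waterRun ℓ → ¬ base ℓ EndsWith colour ℓ
      ball-fits   : length Tb ≤ h
      water-fits  : length Wb ≤ h

    ball-length : length Tb ≡ length (base ℓ) + ballRun ℓ
    ball-length = trans (cong length ball-split) (length-++-replicate (base ℓ) _ (colour ℓ))

    water-length : length Wb ≡ length (base ℓ) + waterRun ℓ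
    water-length = trans (cong length water-split) (length-++-replicate (base ℓ) _ (colour ℓ))

  -- Violated only at a bin being drained after a ball move emptied its ball run.
  Settled : Layer → Set
  Settled ℓ = ballRun ℓ ≡ 0 → waterRun ℓ ≡ 0

  record Layered (T W : Config nb nc) : Set where
    field
      layers   : Fin nb → Layer
      shadows  : ∀ b → Shadows (T b) (W b) (layers b)
      balanced : ∀ d → tally (colour ∘ layers) (ballRun ∘ layers) d
                     ≡ tally (colour ∘ layers) (waterRun ∘ layers) d

  record Shadow (T W : Config nb nc) : Set where
    field
      layered : Layered T W
      settled : ∀ b → Settled (Layered.layers layered b)
    open Layered layered public

  record Draining (T W : Config nb nc) (b₁ : Fin nb) : Set where
    field
      layered : Layered T W
      settled : ∀ b → b ≢ b₁ → Settled (Layered.layers layered b)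
    open Layered layered public

  initial : Fin nc → (S : Config nb nc) → (∀ b → length (S b) ≤ h) → Shadow S S
  initial c₀ S fits = record
    { layered = record
      { layers = λ b → record { base = S b ; colour = c₀ ; ballRun = 0 ; waterRun = 0 }
      ; shadows = λ b → record
        { ball-split = sym (++-identityʳ (S b)) ; water-split = sym (++-identityʳ (S b))
        ; receptive = λ () ; maximal = λ { (inj₁ ()) ; (inj₂ ()) }
        ; ball-fits = fits b ; water-fits = fits b }
      ; balanced = λ _ → refl }
    ; settled = λ _ _ → refl }

  water≤ball : ∀ {Tb Wb ℓ} → Shadows Tb Wb ℓ → Settled ℓ → Tb ≡ [] ⊎ ∃[ c ] Tb ≡ replicate h c →
               waterRun ℓ ≤ ballRun ℓ
  water≤ball {ℓ = ℓ} sh settled (inj₁ Tb≡[]) = ≤-reflexive (trans (settled idle) (sym idle))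
    where
    idle : ballRun ℓ ≡ 0
    idle = m+n≡0⇒n≡0 (length (base ℓ)) (trans (sym (Shadows.ball-length sh)) (cong length Tb≡[]))
  water≤ball {Tb} {Wb} {ℓ} sh _ (inj₂ (c , Tb≡)) = +-cancelˡ-≤ (length (base ℓ)) _ _ (begin
    length (base ℓ) + waterRun ℓ  ≡⟨ sym (Shadows.water-length sh) ⟩
    length Wb                     ≤⟨ Shadows.water-fits sh ⟩
    h                             ≡⟨ sym (trans (cong length Tb≡) (length-replicate h)) ⟩
    length Tb                     ≡⟨ Shadows.ball-length sh ⟩
    length (base ℓ) + ballRun ℓ   ∎)
    where open ≤-Reasoning

  shadow-of-sorted-≗ : ∀ {T W} → Shadow T W → Sorted h T → ∀ b → W b ≡ T b
  shadow-of-sorted-≗ {T} {W} S sorted b = begin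
    W b                               ≡⟨ Shadows.water-split (S.shadows b) ⟩
    base ℓ ++ replicate (waterRun ℓ) c ≡⟨ cong (λ k → base ℓ ++ replicate k c) water≡ball ⟩
    base ℓ ++ replicate (ballRun ℓ) c  ≡⟨ sym (Shadows.ball-split (S.shadows b)) ⟩
    T b                               ∎
    where
    open ≡-Reasoning
    module S = Shadow S
    ℓ : Layer
    ℓ = S.layers b
    c : Fin nc
    c = colour ℓ
    water≡ball : waterRun ℓ ≡ ballRun ℓ
    water≡ball = begin
      waterRun ℓ                                       ≡⟨ sym (units-self c _) ⟩
      units c (waterRun ℓ) c                           ≡⟨ sum-≤-≡ (λ x → units-mono-≤ (colour (S.layers x)) c
                                                            (water≤ball (S.shadows x) (S.settled x) (sorted x)))
                                                          (sym (S.balanced c)) b ⟩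
      units c (ballRun ℓ) c                            ≡⟨ units-self c _ ⟩
      ballRun ℓ                                        ∎

  sorted-shadow : ∀ {T W} → Shadow T W → Sorted h T → Sorted h W
  sorted-shadow S sorted b =
    subst (λ xs → xs ≡ [] ⊎ ∃[ c ] xs ≡ replicate h c) (sym (shadow-of-sorted-≗ S sorted b)) (sorted b)

  tally-replace : ∀ (run : Layer → ℕ) (L : Fin nb → Layer) b ℓ′ → run (L b) ≡ 0 → ∀ d →
                  let L′ = updateAt L b (λ _ → ℓ′) in
                  tally (colour ∘ L′) (run ∘ L′) d ≡ tally (colour ∘ L) (run ∘ L) d + units (colour ℓ′) (run ℓ′) d
  tally-replace run L b ℓ′ idle d =
    sum-raise {f = count ∘ L} {count ∘ updateAt L b (λ _ → ℓ′)} b at-b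
      λ x x≢b → cong count (updateAt-minimal x b L x≢b)
    where
    count : Layer → ℕ
    count ℓ = units (colour ℓ) (run ℓ) d
    at-b : count (updateAt L b (λ _ → ℓ′) b) ≡ count (L b) + count ℓ′
    at-b = begin
      count (updateAt L b (λ _ → ℓ′) b)  ≡⟨ cong count (updateAt-updates b L) ⟩
      count ℓ′                           ≡⟨ cong (_+ count ℓ′) (sym (units-zero (colour (L b)) d)) ⟩
      units (colour (L b)) 0 d + count ℓ′ ≡⟨ cong (λ k → units (colour (L b)) k d + count ℓ′) (sym idle) ⟩
      count (L b) + count ℓ′             ∎
      where open ≡-Reasoning

  record Refocused {T W} (S : Shadow T W) (b : Fin nb) (c : Fin nc) : Set where
    field
      refocused : Shadow T W
      unchanged : ∀ x → x ≢ b → Shadow.layers refocused x ≡ Shadow.layers S x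
      coloured  : colour (Shadow.layers refocused b) ≡ c
      maximal   : ¬ base (Shadow.layers refocused b) EndsWith c
      receptive : Accepts (W b) c
      running   : T b EndsWith c → 0 < ballRun (Shadow.layers refocused b)

  refocus-running : ∀ {T W} (S : Shadow T W) {b c n} → ballRun (Shadow.layers S b) ≡ suc n →
                    Accepts (T b) c → Refocused S b c
  refocus-running {T} {W} S {b} {c} {n} run≡ accepts = record
    { refocused = S ; unchanged = λ _ _ → refl ; coloured = coloured
    ; maximal = subst (λ c → ¬ base ℓ EndsWith c) coloured (Shadows.maximal sh (inj₁ running))
    ; receptive = subst (Accepts _) coloured (Shadows.receptive sh running)
    ; running = λ _ → running }
    where
    module S = Shadow S
    ℓ : Layer
    ℓ = S.layers b
    sh : Shadows (T b) (W b) ℓ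
    sh = S.shadows b
    running : 0 < ballRun ℓ
    running = subst (0 <_) (sym run≡) (s≤s z≤n)
    T≡ : T b ≡ base ℓ ++ replicate (suc n) (colour ℓ)
    T≡ = trans (Shadows.ball-split sh) (cong (λ k → base ℓ ++ replicate k (colour ℓ)) run≡)
    ends : T b EndsWith c
    ends = [ (λ T≡[] → contradiction (subst (_EndsWith _) (trans (sym T≡) T≡[])
                                       (++-replicate-EndsWith (base ℓ) n (colour ℓ)))
                                     ¬[]EndsWith)
           , id ]′ accepts
    coloured : colour ℓ ≡ c
    coloured = ++-replicate-last (base ℓ) n (subst (_EndsWith c) T≡ ends)

  replace-idle : ∀ {T W} (S : Shadow T W) b ℓ′ → ballRun (Shadow.layers S b) ≡ 0 →
                 ballRun ℓ′ ≡ waterRun ℓ′ → Shadows (T b) (W b) ℓ′ → Shadow T W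
  replace-idle {T} {W} S b ℓ′ idle runs≡ sh′ = record
    { layered = record
      { layers = L′
      ; shadows = updateAt-elim (λ x → Shadows (T x) (W x)) b sh′ (λ x _ → S.shadows x)
      ; balanced = λ d → begin
          tally (colour ∘ L′) (ballRun ∘ L′) d
            ≡⟨ tally-replace ballRun S.layers b ℓ′ idle d ⟩
          tally (colour ∘ S.layers) (ballRun ∘ S.layers) d + units (colour ℓ′) (ballRun ℓ′) d
            ≡⟨ cong₂ (λ t k → t + units (colour ℓ′) k d) (S.balanced d) runs≡ ⟩
          tally (colour ∘ S.layers) (waterRun ∘ S.layers) d + units (colour ℓ′) (waterRun ℓ′) d
            ≡⟨ sym (tally-replace waterRun S.layers b ℓ′ (S.settled b idle) d) ⟩
          tally (colour ∘ L′) (waterRun ∘ L′) d ∎ }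
    ; settled = updateAt-elim (λ _ → Settled) b (λ idle′ → trans (sym runs≡) idle′) (λ x _ → S.settled x) }
    where
    open ≡-Reasoning
    module S = Shadow S
    L′ : Fin nb → Layer
    L′ = updateAt S.layers b (λ _ → ℓ′)

  refocus-idle : ∀ {T W} (S : Shadow T W) {b c P k} → ballRun (Shadow.layers S b) ≡ 0 →
                 Accepts (T b) c → base (Shadow.layers S b) ≡ P ++ replicate k c → ¬ P EndsWith c → Refocused S b c
  refocus-idle {T} {W} S {b} {c} {P} {k} idle accepts base≡ top = record
    { refocused = replace-idle S b ℓ′ idle refl sh′
    ; unchanged = λ x x≢b → updateAt-minimal x b S.layers x≢b
    ; coloured = cong colour at-b
    ; maximal = subst (λ ℓ → ¬ base ℓ EndsWith c) (sym at-b) top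
    ; receptive = W-accepts
    ; running = λ ends → subst (λ ℓ → 0 < ballRun ℓ) (sym at-b) (run-positive P k top (subst (_EndsWith c) T≡ ends)) }
    where
    module S = Shadow S
    ℓ : Layer
    ℓ = S.layers b
    ℓ′ : Layer
    ℓ′ = record { base = P ; colour = c ; ballRun = k ; waterRun = k }
    at-b : updateAt S.layers b (λ _ → ℓ′) b ≡ ℓ′
    at-b = updateAt-updates b S.layers
    T≡ : T b ≡ P ++ replicate k c
    T≡ = trans (Shadows.ball-split (S.shadows b))
         (trans (cong (λ j → base ℓ ++ replicate j (colour ℓ)) idle) (trans (++-identityʳ _) base≡))
    W≡ : W b ≡ P ++ replicate k c
    W≡ = trans (Shadows.water-split (S.shadows b))
         (trans (cong (λ j → base ℓ ++ replicate j (colour ℓ)) (S.settled b idle)) (trans (++-identityʳ _) base≡))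
    W-accepts : Accepts (W b) c
    W-accepts = subst (λ xs → Accepts xs c) (trans T≡ (sym W≡)) accepts
    sh′ : Shadows (T b) (W b) ℓ′
    sh′ = record
      { ball-split = T≡ ; water-split = W≡
      ; receptive = λ _ → W-accepts
      ; maximal = λ _ → top
      ; ball-fits = Shadows.ball-fits (S.shadows b) ; water-fits = Shadows.water-fits (S.shadows b) }

  refocus : ∀ {T W} (S : Shadow T W) b c → Accepts (T b) c → Refocused S b c
  refocus S b c accepts with ballRun (Shadow.layers S b) in run≡ | topRun _≟_ (base (Shadow.layers S b)) c
  ... | suc n | _ = refocus-running S run≡ accepts
  ... | zero | P , k , base≡ , top = refocus-idle S run≡ accepts base≡ top

  withBallRuns : (Fin nb → Layer) → (Fin nb → ℕ) → Fin nb → Layer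
  withBallRuns L r x = record (L x) { ballRun = r x }

  shadows-pop : ∀ {Tb Wb ℓ xs} → Shadows Tb Wb ℓ → 0 < ballRun ℓ → Tb ≡ xs ∷ʳ colour ℓ →
                Shadows xs Wb (record ℓ { ballRun = ballRun ℓ ∸ 1 })
  shadows-pop {Tb} {Wb} {ℓ} {xs} sh running Tb≡ = record
    { ball-split = ∷ʳ-injectiveˡ xs _ (begin
        xs ∷ʳ c                                    ≡⟨ sym Tb≡ ⟩
        Tb                                         ≡⟨ Shadows.ball-split sh ⟩
        base ℓ ++ replicate (ballRun ℓ) c           ≡⟨ cong (λ k → base ℓ ++ replicate k c) (sym (m∸n+n≡m running)) ⟩
        base ℓ ++ replicate (ballRun ℓ ∸ 1 + 1) c   ≡⟨ ++-replicate-+ (base ℓ) (ballRun ℓ ∸ 1) 1 c ⟩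
        (base ℓ ++ replicate (ballRun ℓ ∸ 1) c) ∷ʳ c ∎)
    ; water-split = Shadows.water-split sh
    ; receptive = λ _ → Shadows.receptive sh running
    ; maximal = λ _ → Shadows.maximal sh (inj₁ running)
    ; ball-fits = ≤-trans (length-++-≤ˡ xs) (subst (λ ys → length ys ≤ h) Tb≡ (Shadows.ball-fits sh))
    ; water-fits = Shadows.water-fits sh }
    where
    open ≡-Reasoning
    c : Fin nc
    c = colour ℓ

  shadows-push : ∀ {Tb Wb ℓ} → Shadows Tb Wb ℓ → Accepts Wb (colour ℓ) → ¬ base ℓ EndsWith colour ℓ →
                 length Tb < h → Shadows (Tb ∷ʳ colour ℓ) Wb (record ℓ { ballRun = ballRun ℓ + 1 })
  shadows-push {Tb} {Wb} {ℓ} sh accepts top room = record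
    { ball-split = trans (cong (_∷ʳ colour ℓ) (Shadows.ball-split sh))
                         (sym (++-replicate-+ (base ℓ) (ballRun ℓ) 1 (colour ℓ)))
    ; water-split = Shadows.water-split sh
    ; receptive = λ _ → accepts
    ; maximal = λ _ → top
    ; ball-fits = subst (_≤ h) (sym (trans (length-++ Tb) (+-comm (length Tb) 1))) room
    ; water-fits = Shadows.water-fits sh }

  record Prepared (T W : Config nb nc) (b₁ b₂ : Fin nb) (c : Fin nc) : Set where
    field
      shadow           : Shadow T W
      source-colour    : colour (Shadow.layers shadow b₁) ≡ c
      source-running   : 0 < ballRun (Shadow.layers shadow b₁)
      target-colour    : colour (Shadow.layers shadow b₂) ≡ c
      target-maximal   : ¬ base (Shadow.layers shadow b₂) EndsWith c
      target-receptive : Accepts (W b₂) c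

  prepare : ∀ {T W b₁ b₂ c} → Shadow T W → b₁ ≢ b₂ → T b₁ EndsWith c → Accepts (T b₂) c → Prepared T W b₁ b₂ c
  prepare {T} {W} {b₁} {b₂} {c} S b₁≢b₂ ends₁ accepts₂ = record
    { shadow = Refocused.refocused R₁
    ; source-colour = Refocused.coloured R₁
    ; source-running = Refocused.running R₁ ends₁
    ; target-colour = trans (cong colour L₂≡) (Refocused.coloured R₂)
    ; target-maximal = subst (λ ℓ → ¬ base ℓ EndsWith c) (sym L₂≡) (Refocused.maximal R₂)
    ; target-receptive = Refocused.receptive R₂ }
    where
    R₂ : Refocused S b₂ c
    R₂ = refocus S b₂ c accepts₂
    R₁ : Refocused (Refocused.refocused R₂) b₁ c
    R₁ = refocus (Refocused.refocused R₂) b₁ c (inj₂ ends₁)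
    L₂≡ : Shadow.layers (Refocused.refocused R₁) b₂ ≡ Shadow.layers (Refocused.refocused R₂) b₂
    L₂≡ = Refocused.unchanged R₁ b₂ (b₁≢b₂ ∘ sym)

  moveBall : ∀ {T T′ W b₁ b₂ xs c} → b₁ ≢ b₂ → T b₁ ≡ xs ∷ʳ c → length (T b₂) < h →
             T′ b₁ ≡ xs → T′ b₂ ≡ T b₂ ∷ʳ c → (∀ y → y ≢ b₁ → y ≢ b₂ → T′ y ≡ T y) →
             Prepared T W b₁ b₂ c → Draining T′ W b₁
  moveBall {T} {T′} {W} {b₁} {b₂} {xs} {c} b₁≢b₂ T₁≡ room T′₁≡ T′₂≡ rest P =
    record { layered = layered′ ; settled = settled′ }
    where
    open Prepared P
    module S = Shadow shadow
    L : Fin nb → Layer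
    L = S.layers
    r′ : Fin nb → ℕ
    r′ = transfer 1 b₁ b₂ (ballRun ∘ L)
    L′ : Fin nb → Layer
    L′ = withBallRuns L r′
    shadow₁ : Shadows (T′ b₁) (W b₁) (L′ b₁)
    shadow₁ = subst₂ (λ Tb ℓ → Shadows Tb (W b₁) ℓ) (sym T′₁≡)
                (cong (λ k → record (L b₁) { ballRun = k }) (sym (updateAt₂-first b₁≢b₂)))
                (shadows-pop (S.shadows b₁) source-running (subst (λ c → T b₁ ≡ xs ∷ʳ c) (sym source-colour) T₁≡))
    shadow₂ : Shadows (T′ b₂) (W b₂) (L′ b₂)
    shadow₂ = subst₂ (λ Tb ℓ → Shadows Tb (W b₂) ℓ) (trans (cong (T b₂ ∷ʳ_) target-colour) (sym T′₂≡))
                (cong (λ k → record (L b₂) { ballRun = k }) (sym (updateAt₂-second b₁≢b₂)))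
                (shadows-push (S.shadows b₂)
                  (subst (Accepts (W b₂)) (sym target-colour) target-receptive)
                  (subst (λ c → ¬ base (L b₂) EndsWith c) (sym target-colour) target-maximal)
                  room)
    layered′ : Layered T′ W
    layered′ = record
      { layers = L′
      ; shadows = elim₂ {P = λ x → Shadows (T′ x) (W x) (L′ x)} b₁ b₂ shadow₁ shadow₂ λ x x≢b₁ x≢b₂ →
          subst₂ (λ Tb ℓ → Shadows Tb (W x) ℓ) (sym (rest x x≢b₁ x≢b₂))
            (cong (λ k → record (L x) { ballRun = k }) (sym (updateAt₂-minimal x x≢b₁ x≢b₂))) (S.shadows x)
      ; balanced = λ d → trans (tally-transfer (colour ∘ L) (ballRun ∘ L) (trans source-colour (sym target-colour))
                                                 source-running d)
                               (S.balanced d) }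
    settled′ : ∀ x → x ≢ b₁ → Settled (L′ x)
    settled′ = elim₂ {P = λ x → x ≢ b₁ → Settled (L′ x)} b₁ b₂ (λ b₁≢b₁ → contradiction refl b₁≢b₁)
      (λ _ idle → contradiction (trans (sym (updateAt₂-second b₁≢b₂)) idle) (m+1+n≢0 (ballRun (L b₂)) {0}))
      (λ x x≢b₁ x≢b₂ _ idle → S.settled x (trans (sym (updateAt₂-minimal x x≢b₁ x≢b₂)) idle))

  afterBall : ∀ {T T′ W} → BallMove h T T′ → Shadow T W → ∃[ b₁ ] Draining T′ W b₁
  afterBall (b₁ , b₂ , b₁≢b₂ , xs , c , T₁≡ , accepts₂ , room , T′₁≡ , T′₂≡ , rest) S =
    b₁ , moveBall b₁≢b₂ T₁≡ room T′₁≡ T′₂≡ rest (prepare S b₁≢b₂ (xs , T₁≡) accepts₂)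

  withWaterRuns : (Fin nb → Layer) → (Fin nb → ℕ) → Fin nb → Layer
  withWaterRuns L r x = record (L x) { waterRun = r x }

  shadows-lower : ∀ {Tb Wb ℓ} k → Shadows Tb Wb ℓ → ballRun ℓ ≡ 0 → 0 < waterRun ℓ → k ≤ waterRun ℓ →
                  Shadows Tb (base ℓ ++ replicate k (colour ℓ)) (record ℓ { waterRun = k })
  shadows-lower {Tb} {Wb} {ℓ} k sh idle wet k≤w = record
    { ball-split = Shadows.ball-split sh
    ; water-split = refl
    ; receptive = λ running → contradiction (sym idle) (<⇒≢ running)
    ; maximal = λ _ → Shadows.maximal sh (inj₂ wet)
    ; ball-fits = Shadows.ball-fits sh
    ; water-fits = begin
        length (base ℓ ++ replicate k (colour ℓ)) ≡⟨ length-++-replicate (base ℓ) k (colour ℓ) ⟩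
        length (base ℓ) + k                       ≤⟨ +-monoʳ-≤ (length (base ℓ)) k≤w ⟩
        length (base ℓ) + waterRun ℓ              ≡⟨ sym (Shadows.water-length sh) ⟩
        length Wb                                 ≤⟨ Shadows.water-fits sh ⟩
        h                                         ∎ }
    where open ≤-Reasoning

  shadows-raise : ∀ {Tb Wb ℓ m} → Shadows Tb Wb ℓ → waterRun ℓ < ballRun ℓ → 0 < m → length Wb + m ≤ h →
                  Shadows Tb (Wb ++ replicate m (colour ℓ)) (record ℓ { waterRun = waterRun ℓ + m })
  shadows-raise {Tb} {Wb} {ℓ} {suc m} sh short (s≤s z≤n) fits = record
    { ball-split = Shadows.ball-split sh
    ; water-split = trans (cong (_++ replicate (suc m) (colour ℓ)) (Shadows.water-split sh))
                          (sym (++-replicate-+ (base ℓ) (waterRun ℓ) (suc m) (colour ℓ)))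
    ; receptive = λ _ → inj₂ (++-replicate-EndsWith Wb m (colour ℓ))
    ; maximal = λ _ → Shadows.maximal sh (inj₁ (≤-<-trans z≤n short))
    ; ball-fits = Shadows.ball-fits sh
    ; water-fits = subst (_≤ h) (sym (length-++-replicate Wb (suc m) (colour ℓ))) fits }

  water-room : ∀ {Tb Wb ℓ} → Shadows Tb Wb ℓ → waterRun ℓ < ballRun ℓ → length Wb < h
  water-room {Tb} {Wb} {ℓ} sh short = begin-strict
    length Wb                     ≡⟨ Shadows.water-length sh ⟩
    length (base ℓ) + waterRun ℓ  <⟨ +-monoʳ-< (length (base ℓ)) short ⟩
    length (base ℓ) + ballRun ℓ   ≡⟨ sym (Shadows.ball-length sh) ⟩
    length Tb                     ≤⟨ Shadows.ball-fits sh ⟩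
    h                             ∎
    where open ≤-Reasoning

  receiver : ∀ {T W} (S : Layered T W) {b₁} → let L = Layered.layers S in
             ballRun (L b₁) ≡ 0 → 0 < waterRun (L b₁) →
             ∃[ x ] colour (L x) ≡ colour (L b₁) × waterRun (L x) < ballRun (L x)
  receiver S {b₁} idle wet =
    map₂ (λ {x} short → units-<⁻¹ (colour (S.layers x)) c short)
         (sum-deficit {f = count waterRun} {count ballRun} {b₁} (sym (S.balanced c)) deficit)
    where
    module S = Layered S
    c : Fin nc
    c = colour (S.layers b₁)
    count : (Layer → ℕ) → Fin nb → ℕ
    count run x = units (colour (S.layers x)) (run (S.layers x)) c
    deficit : count ballRun b₁ < count waterRun b₁
    deficit = subst₂ _<_ (sym (trans (units-self c _) idle)) (sym (units-self c _)) wet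

  module Pour {T W b₁} (D : Draining T W b₁) (idle : ballRun (Draining.layers D b₁) ≡ 0)
              (wet : 0 < waterRun (Draining.layers D b₁)) where
    open Draining D

    L : Fin nb → Layer
    L = layers

    c : Fin nc
    c = colour (L b₁)

    w₁ : ℕ
    w₁ = waterRun (L b₁)

    x : Fin nb
    x = proj₁ (receiver layered idle wet)

    cₓ : colour (L x) ≡ c
    cₓ = proj₁ (proj₂ (receiver layered idle wet))

    shortₓ : waterRun (L x) < ballRun (L x)
    shortₓ = proj₂ (proj₂ (receiver layered idle wet))

    b₁≢x : b₁ ≢ x
    b₁≢x b₁≡x = n≮0 (subst (w₁ <_) idle (subst (λ y → waterRun (L y) < ballRun (L y)) (sym b₁≡x) shortₓ))

    room : length (W x) < h
    room = water-room (shadows x) shortₓ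

    -- Pouring as much as fits makes the move maximal: the run runs out or x fills up.
    m : ℕ
    m = w₁ ⊓ (h ∸ length (W x))

    0<m : 0 < m
    0<m = ⊓-glb wet (m<n⇒0<n∸m room)

    m≤w₁ : m ≤ w₁
    m≤w₁ = m⊓n≤m w₁ _

    fits : length (W x) + m ≤ h
    fits = ≤-trans (+-monoʳ-≤ (length (W x)) (m⊓n≤n w₁ _)) (≤-reflexive (m+[n∸m]≡n (<⇒≤ room)))

    w′ : Fin nb → ℕ
    w′ = transfer m b₁ x (waterRun ∘ L)

    W′ : Config nb nc
    W′ y = base (L y) ++ replicate (w′ y) (colour (L y))

    xs : List (Fin nc)
    xs = base (L b₁) ++ replicate (w₁ ∸ m) c

    W₁≡ : W b₁ ≡ xs ++ replicate m c
    W₁≡ = trans (Shadows.water-split (shadows b₁))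
          (trans (cong (λ k → base (L b₁) ++ replicate k c) (sym (m∸n+n≡m m≤w₁)))
                 (++-replicate-+ (base (L b₁)) (w₁ ∸ m) m c))

    W′ₓ≡ : W′ x ≡ W x ++ replicate m (colour (L x))
    W′ₓ≡ = trans (cong (λ k → base (L x) ++ replicate k (colour (L x))) (updateAt₂-second b₁≢x))
           (trans (++-replicate-+ (base (L x)) (waterRun (L x)) m (colour (L x)))
                  (cong (_++ replicate m (colour (L x))) (sym (Shadows.water-split (shadows x)))))

    unpoured : ∀ y → y ≢ b₁ → y ≢ x → W′ y ≡ W y
    unpoured y y≢b₁ y≢x = trans (cong (λ k → base (L y) ++ replicate k (colour (L y))) (updateAt₂-minimal y y≢b₁ y≢x))
                                (sym (Shadows.water-split (shadows y)))

    maximality : ¬ xs EndsWith c ⊎ length (W x) + m ≡ h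
    maximality = [ (λ m≡w₁ → inj₁ (subst (λ ys → ¬ ys EndsWith c) (sym (xs≡base m≡w₁))
                                          (Shadows.maximal (shadows b₁) (inj₂ wet))))
                 , (λ m≡gap → inj₂ (trans (cong (length (W x) +_) m≡gap) (m+[n∸m]≡n (<⇒≤ room)))) ]′
                 (⊓-sel w₁ (h ∸ length (W x)))
      where
      xs≡base : m ≡ w₁ → xs ≡ base (L b₁)
      xs≡base m≡w₁ = trans (cong (λ k → base (L b₁) ++ replicate (w₁ ∸ k) c) m≡w₁)
                           (trans (cong (λ k → base (L b₁) ++ replicate k c) (n∸n≡0 w₁)) (++-identityʳ _))

    step : WaterMove h W W′
    step = b₁ , x , b₁≢x , c , m , 0<m , xs , W₁≡
         , subst (Accepts (W x)) cₓ (Shadows.receptive (shadows x) (≤-<-trans z≤n shortₓ))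
         , fits , maximality
         , cong (λ k → base (L b₁) ++ replicate k c) (updateAt₂-first b₁≢x)
         , trans W′ₓ≡ (cong (λ c → W x ++ replicate m c) cₓ)
         , unpoured

    L′ : Fin nb → Layer
    L′ = withWaterRuns L w′

    drained : Draining T W′ b₁
    drained = record
      { layered = record
        { layers = L′
        ; shadows = elim₂ {P = λ y → Shadows (T y) (W′ y) (L′ y)} b₁ x
            (subst (λ k → Shadows (T b₁) (base (L b₁) ++ replicate k c) (record (L b₁) { waterRun = k }))
                   (sym (updateAt₂-first b₁≢x)) (shadows-lower (w₁ ∸ m) (shadows b₁) idle wet (m∸n≤m w₁ m)))
            (subst₂ (Shadows (T x)) (sym W′ₓ≡)
                    (cong (λ k → record (L x) { waterRun = k }) (sym (updateAt₂-second b₁≢x)))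
                    (shadows-raise (shadows x) shortₓ 0<m fits))
            λ y y≢b₁ y≢x → subst₂ (Shadows (T y)) (sym (unpoured y y≢b₁ y≢x))
                             (cong (λ k → record (L y) { waterRun = k }) (sym (updateAt₂-minimal y y≢b₁ y≢x)))
                             (shadows y)
        ; balanced = λ d → trans (balanced d) (sym (tally-transfer (colour ∘ L) (waterRun ∘ L) (sym cₓ) m≤w₁ d)) }
      ; settled = elim₂ {P = λ y → y ≢ b₁ → Settled (L′ y)} b₁ x (λ b₁≢b₁ → contradiction refl b₁≢b₁)
          (λ _ idleₓ → contradiction (subst (waterRun (L x) <_) idleₓ shortₓ) n≮0)
          (λ y y≢b₁ y≢x _ idleʸ → trans (updateAt₂-minimal y y≢b₁ y≢x) (settled y y≢b₁ idleʸ)) }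

    lowered : waterRun (L′ b₁) < w₁
    lowered = subst (_< w₁) (sym (updateAt₂-first b₁≢x)) (∸-monoʳ-< {o = 0} 0<m m≤w₁)

  settle : ∀ {T W b₁} (D : Draining T W b₁) → Settled (Draining.layers D b₁) → Shadow T W
  settle {b₁ = b₁} D settled₁ = record { layered = Draining.layered D ; settled = settled }
    where
    settled : ∀ y → Settled (Draining.layers D y)
    settled y with y ≟ b₁
    ... | yes refl = settled₁
    ... | no y≢b₁ = Draining.settled D y y≢b₁

  excess : ∀ {T W b₁} → Draining T W b₁ → ℕ
  excess {b₁ = b₁} D = waterRun (Draining.layers D b₁)

  settle-or-pour : ∀ {T W b₁} (D : Draining T W b₁) →
                   Shadow T W ⊎ ∃[ W′ ] WaterMove h W W′ × Σ[ D′ ∈ Draining T W′ b₁ ] excess D′ < excess D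
  settle-or-pour {b₁ = b₁} D with ballRun (Draining.layers D b₁) ≟ℕ 0 | excess D ≟ℕ 0
  ... | no running | _ = inj₁ (settle D λ idle → contradiction idle running)
  ... | yes _ | yes dry = inj₁ (settle D λ _ → dry)
  ... | yes idle | no wet = inj₂ (W′ , step , drained , lowered)
    where open Pour D idle (n≢0⇒n>0 wet)

  drain : ∀ {T W b₁} (D : Draining T W b₁) → Acc _<_ (excess D) → ∃[ W′ ] Star (WaterMove h) W W′ × Shadow T W′
  drain D (acc smaller) with settle-or-pour D
  ... | inj₁ S = _ , ε , S
  ... | inj₂ (_ , step , D′ , lowered) with drain D′ (smaller lowered)
  ...   | W′ , steps , S = W′ , step ◅ steps , S

  ballStep : ∀ {T T′ W} → BallMove h T T′ → Shadow T W → ∃[ W′ ] Star (WaterMove h) W W′ × Shadow T′ W′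
  ballStep move S = drain D (<-wellFounded (excess D))
    where
    D : Draining _ _ (proj₁ (afterBall move S))
    D = proj₂ (afterBall move S)

  simulate : ∀ {T T* W} → Star (BallMove h) T T* → Sorted h T* → Shadow T W → WSP h W
  simulate {W = W} ε sorted S = W , ε , sorted-shadow S sorted
  simulate (move ◅ moves) sorted S with ballStep move S
  ... | _ , steps , S′ with simulate moves sorted S′
  ...   | W* , steps′ , sorted* = W* , steps ◅◅ steps′ , sorted*

module WaterToBall (h : ℕ) {nb nc : ℕ} where

  pourUnits : ∀ m {S S′ : Config nb nc} {b₁ b₂ xs c} → b₁ ≢ b₂ →
              S b₁ ≡ xs ++ replicate (suc m) c → Accepts (S b₂) c → length (S b₂) + suc m ≤ h →
              S′ b₁ ≡ xs → S′ b₂ ≡ S b₂ ++ replicate (suc m) c → (∀ y → y ≢ b₁ → y ≢ b₂ → S′ y ≡ S y) →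
              Star (BallMove h) S S′
  pourUnits zero {S} {b₂ = b₂} b₁≢b₂ S₁≡ accepts fits S′₁≡ S′₂≡ rest =
    (_ , _ , b₁≢b₂ , _ , _ , S₁≡ , accepts , subst (_≤ h) (+-comm (length (S b₂)) 1) fits , S′₁≡ , S′₂≡ , rest) ◅ ε
  pourUnits (suc m) {S} {S′} {b₁} {b₂} {xs} {c} b₁≢b₂ S₁≡ accepts fits S′₁≡ S′₂≡ rest =
    (b₁ , b₂ , b₁≢b₂ , xs ++ replicate (suc m) c , c , trans S₁≡ (sym (++-replicate-∷ʳ xs (suc m) c)) , accepts
        , <-≤-trans (m<m+n (length (S b₂)) (s≤s z≤n)) fits
        , U₁≡ , U₂≡ , λ y y≢b₁ y≢b₂ → updateAt₂-minimal y y≢b₁ y≢b₂)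
    ◅ pourUnits m b₁≢b₂ U₁≡ (inj₂ (S b₂ , U₂≡)) fits′ S′₁≡ S′₂≡′
        λ y y≢b₁ y≢b₂ → trans (rest y y≢b₁ y≢b₂) (sym (updateAt₂-minimal y y≢b₁ y≢b₂))
    where
    U : Config nb nc
    U = updateAt₂ S b₁ (λ _ → xs ++ replicate (suc m) c) b₂ (_∷ʳ c)
    U₁≡ : U b₁ ≡ xs ++ replicate (suc m) c
    U₁≡ = updateAt₂-first b₁≢b₂
    U₂≡ : U b₂ ≡ S b₂ ∷ʳ c
    U₂≡ = updateAt₂-second b₁≢b₂
    fits′ : length (U b₂) + suc m ≤ h
    fits′ = subst (_≤ h) (sym (trans (cong (λ ys → length ys + suc m) U₂≡)
                               (trans (cong (_+ suc m) (length-++ (S b₂))) (+-assoc (length (S b₂)) 1 (suc m))))) fits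
    S′₂≡′ : S′ b₂ ≡ U b₂ ++ replicate (suc m) c
    S′₂≡′ = trans S′₂≡ (trans (sym (∷ʳ-++ (S b₂) c (replicate (suc m) c))) (cong (_++ replicate (suc m) c) (sym U₂≡)))

  waterMove⇒ballMoves : ∀ {S S′ : Config nb nc} → WaterMove h S S′ → Star (BallMove h) S S′
  waterMove⇒ballMoves (_ , _ , _ , _ , zero , () , _)
  waterMove⇒ballMoves (_ , _ , b₁≢b₂ , _ , suc m , _ , _ , S₁≡ , accepts , fits , _ , S′₁≡ , S′₂≡ , rest) =
    pourUnits m b₁≢b₂ S₁≡ accepts fits S′₁≡ S′₂≡ rest

colourless-sorted : ∀ {h nb} (S : Config nb 0) → Sorted h S
colourless-sorted S b with S b
... | [] = inj₁ refl
... | () ∷ _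

ballSorting⇒waterSorting : ∀ {h nb} nc (S : Config nb nc) → (∀ b → length (S b) ≤ h) → BSP h S → WSP h S
-- Layers need a colour to start from; without colours everything is sorted anyway.
ballSorting⇒waterSorting zero S _ _ = S , ε , colourless-sorted S
ballSorting⇒waterSorting {h} (suc _) S fits (T , moves , sorted) = simulate moves sorted (initial zero S fits)
  where open BallToWater h

corollary4 : (h : ℕ) → h ≥ 1 → (nb nc : ℕ) → (S₀ : Config nb nc) →
    IsInstance h S₀ → (BSP h S₀ → WSP h S₀) × (WSP h S₀ → BSP h S₀)
corollary4 h _ nb nc S₀ (full-or-empty , _) =
  ballSorting⇒waterSorting nc S₀ fits , λ (T , steps , sorted) → T , (waterMove⇒ballMoves ⋆) steps , sorted
  where
  open WaterToBall h
  fits : ∀ b → length (S₀ b) ≤ h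
  fits b = [ ≤-reflexive , (λ S₀b≡[] → subst (λ xs → length xs ≤ h) (sym S₀b≡[]) z≤n) ]′ (full-or-empty b)
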